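{- There is a constant $c$ such that the following holds. Let $G=\langle V,E\rangle$ be a non-Hamiltonian simple directed graph with $n=\mathrm{card}(V)>0$ vertices, let $p:[n]\to V$ be any map (a sequence of $n$ vertices), and let $\mathcal{X}_p=\{X_{1,p[1]},\dots,X_{n,p[n]}\}$. Then there is a normal tree-like intuitionistic natural deduction $\Pi_p$ with conclusion $\bot$, all of whose open assumptions belong to $\mathcal{X}_p\cup\{\alpha_G\}$, and with $\mathrm{height}(\Pi_p)\le c\,n^2$.
   Context: A simple directed graph $G=\langle V,E\rangle$ has finite vertex set $V$ and edge set $E\subseteq V\times V$, with at most one edge from $v_1$ to $v_2$ for every ordered pair $(v_1,v_2)$. Write $[n]=\{1,\dots,n\}$. A Hamiltonian path in $G$ is a sequence of vertices $v_1\ldots v_n$ such that $i\mapsto v_i$ is a bijection of $[n]$ onto $V$ and $(v_i,v_{i+1})\in E$ for every $0<i<n$; $G$ is non-Hamiltonian iff it has no Hamiltonian path. Formulas are propositional formulas built from propositional variables and $\bot$ using $\wedge,\vee,\rightarrow$. For propositional variables $X_{i,v}$ ($i\in[n]$, $v\in V$) define $A=\bigwedge_{v\in V}(X_{1,v}\vee\cdots\vee X_{n,v})$, $B=\bigwedge_{v\in V}\bigwedge_{i\neq j}(X_{i,v}\rightarrow(X_{j,v}\rightarrow\bot))$ (inner conjunction over ordered pairs $i\neq j$ in $[n]$), $C=\bigwedge_{i\in[n]}\bigvee_{v\in V}X_{i,v}$, $D=\bigwedge_{v\neq w}\bigwedge_{i\in[n]}(X_{i,v}\rightarrow(X_{i,w}\rightarrow\bot))$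 (outer conjunction over ordered pairs of distinct vertices), $E'=\bigwedge_{(v,w)\notin E}\bigwedge_{i\in[n-1]}(X_{i,v}\rightarrow(X_{i+1,w}\rightarrow\bot))$ (outer conjunction over ordered pairs $(v,w)\in V\times V$ not in $E$), where each iterated $\bigwedge,\bigvee$ denotes an iterated binary conjunction/disjunction over the index set, nested as written, and $\alpha_G:=A\wedge B\wedge C\wedge D\wedge E'$. Natural deduction is the standard Prawitz-style tree-like natural deduction for intuitionistic propositional logic; a deduction is normal if it contains no formula occurrence that is the conclusion of an introduction (or of a $\vee$-elimination) and the major premise of an elimination; height is the maximal number of formula occurrences on a branch from root to leaf. -}

module Defs where

open import Data.Nat using (ℕ; zero; suc; _⊔_; _*_; _≤_; _<_)
import Data.Nat as ℕ
open import Data.Fin using (Fin; toℕ)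
import Data.Fin as F
open import Data.Bool using (Bool; true; false; if_then_else_; not)
open import Data.List using (List; []; _∷_; [_]; map; concatMap; allFin)
open import Data.List.Membership.Propositional using (_∈_)
open import Data.Product using (Σ; _×_; _,_)
open import Data.Empty using (⊥)
open import Data.Unit using (⊤)
open import Relation.Nullary using (¬_; ⌊_⌋)
open import Relation.Binary.PropositionalEquality using (_≡_)
open import Function.Definitions using (Bijective)

infixr 6 _∧'_
infixr 5 _∨'_
infixr 4 _⇒_

data Form (A : Set) : Set where
  var  : A → Form A
  ⊥'   : Form A
  _∧'_ : Form A → Form A → Form A
  _∨'_ : Form A → Form A → Form A
  _⇒_  : Form A → Form A → Form A

module _ {A : Set} where

  ⊤' : Form A
  ⊤' = ⊥' ⇒ ⊥'

  ⋀ : List (Form A) → Form A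
  ⋀ []           = ⊤'
  ⋀ (a ∷ [])     = a
  ⋀ (a ∷ b ∷ as) = a ∧' ⋀ (b ∷ as)

  ⋁ : List (Form A) → Form A
  ⋁ []           = ⊥'
  ⋁ (a ∷ [])     = a
  ⋁ (a ∷ b ∷ as) = a ∨' ⋁ (b ∷ as)

-- A deduction Γ ⊢ φ is a
-- deduction of φ all of whose open assumptions belong to Γ.

infix 2 _⊢_

data _⊢_ {A : Set} (Γ : List (Form A)) : Form A → Set where
  ass  : ∀ {φ} → φ ∈ Γ → Γ ⊢ φ
  ∧I   : ∀ {φ ψ} → Γ ⊢ φ → Γ ⊢ ψ → Γ ⊢ φ ∧' ψ
  ∧E₁  : ∀ {φ ψ} → Γ ⊢ φ ∧' ψ → Γ ⊢ φ
  ∧E₂  : ∀ {φ ψ} → Γ ⊢ φ ∧' ψ → Γ ⊢ ψ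
  ∨I₁  : ∀ {φ ψ} → Γ ⊢ φ → Γ ⊢ φ ∨' ψ
  ∨I₂  : ∀ {φ ψ} → Γ ⊢ ψ → Γ ⊢ φ ∨' ψ
  ∨E   : ∀ {φ ψ χ} → Γ ⊢ φ ∨' ψ → (φ ∷ Γ) ⊢ χ → (ψ ∷ Γ) ⊢ χ → Γ ⊢ χ
  ⇒I   : ∀ {φ ψ} → (φ ∷ Γ) ⊢ ψ → Γ ⊢ φ ⇒ ψ
  ⇒E   : ∀ {φ ψ} → Γ ⊢ φ ⇒ ψ → Γ ⊢ φ → Γ ⊢ ψ
  ⊥E   : ∀ {φ} → Γ ⊢ ⊥' → Γ ⊢ φ

module _ {A : Set} where

  -- height: maximal number of formula occurrences on a branch root→leaf
  height : ∀ {Γ : List (Form A)} {φ} → Γ ⊢ φ → ℕ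
  height (ass _)     = 1
  height (∧I d e)    = suc (height d ⊔ height e)
  height (∧E₁ d)     = suc (height d)
  height (∧E₂ d)     = suc (height d)
  height (∨I₁ d)     = suc (height d)
  height (∨I₂ d)     = suc (height d)
  height (∨E d e f)  = suc (height d ⊔ height e ⊔ height f)
  height (⇒I d)      = suc (height d)
  height (⇒E d e)    = suc (height d ⊔ height e)
  height (⊥E d)      = suc (height d)

  IntroOr∨E : ∀ {Γ : List (Form A)} {φ} → Γ ⊢ φ → Set
  IntroOr∨E (∧I _ _)   = ⊤
  IntroOr∨E (∨I₁ _)    = ⊤
  IntroOr∨E (∨I₂ _)    = ⊤
  IntroOr∨E (⇒I _)     = ⊤
  IntroOr∨E (∨E _ _ _) = ⊤
  IntroOr∨E _          = ⊥

  Normal : ∀ {Γ : List (Form A)} {φ} → Γ ⊢ φ → Set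
  Normal (ass _)     = ⊤
  Normal (∧I d e)    = Normal d × Normal e
  Normal (∧E₁ d)     = ¬ IntroOr∨E d × Normal d
  Normal (∧E₂ d)     = ¬ IntroOr∨E d × Normal d
  Normal (∨I₁ d)     = Normal d
  Normal (∨I₂ d)     = Normal d
  Normal (∨E d e f)  = ¬ IntroOr∨E d × Normal d × Normal e × Normal f
  Normal (⇒I d)      = Normal d
  Normal (⇒E d e)    = ¬ IntroOr∨E d × Normal d × Normal e
  Normal (⊥E d)      = Normal d

-- Simple directed graphs on V = Fin n (vertices), with edge relation
-- given by its characteristic function.  Positions [n] = Fin n
-- (position i+1 of the paper is Fin element i).

Graph : ℕ → Set
Graph n = Fin n → Fin n → Bool

Succ : ∀ {n} → Fin n → Fin n → Set
Succ i j = toℕ j ≡ suc (toℕ i)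

HamiltonianPath : ∀ {n} → Graph n → (Fin n → Fin n) → Set
HamiltonianPath {n} G v =
  Bijective _≡_ _≡_ v × (∀ (i j : Fin n) → Succ i j → G (v i) (v j) ≡ true)

NonHamiltonian : ∀ {n} → Graph n → Set
NonHamiltonian {n} G = ¬ Σ (Fin n → Fin n) (HamiltonianPath G)

Var : ℕ → Set
Var n = Fin n × Fin n   -- (position i , vertex v)

X : ∀ {n} → Fin n → Fin n → Form (Var n)
X i v = var (i , v)

distinctPairs : ∀ n → List (Fin n × Fin n)
distinctPairs n = concatMap (λ a → concatMap (λ b →
  if ⌊ a F.≟ b ⌋ then [] else [ (a , b) ]) (allFin n)) (allFin n)

nonEdges : ∀ {n} → Graph n → List (Fin n × Fin n)
nonEdges {n} G = concatMap (λ v → concatMap (λ w →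
  if G v w then [] else [ (v , w) ]) (allFin n)) (allFin n)

succPairs : ∀ n → List (Fin n × Fin n)
succPairs n = concatMap (λ i → concatMap (λ j →
  if ⌊ toℕ j ℕ.≟ suc (toℕ i) ⌋ then [ (i , j) ] else []) (allFin n)) (allFin n)

module _ {n : ℕ} (G : Graph n) where

  Aᶠ : Form (Var n)
  Aᶠ = ⋀ (map (λ v → ⋁ (map (λ i → X i v) (allFin n))) (allFin n))

  Bᶠ : Form (Var n)
  Bᶠ = ⋀ (map (λ v → ⋀ (map (λ { (i , j) → X i v ⇒ (X j v ⇒ ⊥') })
                              (distinctPairs n))) (allFin n))

  Cᶠ : Form (Var n)
  Cᶠ = ⋀ (map (λ i → ⋁ (map (λ v → X i v) (allFin n))) (allFin n))

  Dᶠ : Form (Var n)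
  Dᶠ = ⋀ (map (λ { (v , w) → ⋀ (map (λ i → X i v ⇒ (X i w ⇒ ⊥')) (allFin n)) })
              (distinctPairs n))

  E'ᶠ : Form (Var n)
  E'ᶠ = ⋀ (map (λ { (v , w) → ⋀ (map (λ { (i , i+1) → X i v ⇒ (X i+1 w ⇒ ⊥') })
                                       (succPairs n)) })
               (nonEdges G))

  α : Form (Var n)
  α = Aᶠ ∧' Bᶠ ∧' Cᶠ ∧' Dᶠ ∧' E'ᶠ

Hyps : ∀ {n} → Graph n → (Fin n → Fin n) → List (Form (Var n))
Hyps {n} G p = α G ∷ map (λ i → X i (p i)) (allFin n)

-- If p is not a Hamiltonian path then, since an injective map Fin n → Fin n
-- is a bijection, either two positions i ≠ j carry the same vertex or two
-- consecutive positions carry a non-edge.  In the first case the conjunct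
-- X_{i,v} → X_{j,v} → ⊥ of B, in the second the conjunct
-- X_{i,v} → X_{i+1,w} → ⊥ of E', is reached from α by a chain of
-- ∧-eliminations and applied to two assumptions of 𝒳_p.  Such a deduction is
-- normal, and its height is dominated by the lengths of the two iterated
-- conjunctions passed through, each at most n².
module Submission where

open import Defs
open import Data.Bool using (true; false; if_then_else_)
import Data.Bool.Properties as Bool
open import Data.Fin using (Fin; toℕ; punchOut)
open import Data.Fin.Properties using (any?; punchOut-injective; injective⇒≤; _≟_)
open import Data.List using (List; []; _∷_; map; concatMap; allFin; length)
open import Data.List.Properties using (length-map; length-tabulate; length-++)
open import Data.List.Membership.Propositional using (_∈_)
open import Data.List.Membership.Propositional.Properties
  using (∈-map⁺; ∈-concatMap⁺; ∈-allFin)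
open import Data.List.Relation.Unary.Any using (here; there)
import Data.List.Relation.Unary.Any as Any
open import Data.Nat using (ℕ; zero; suc; _+_; _*_; _≤_; _<_; z≤n; s≤s)
import Data.Nat as ℕ
open import Data.Nat.Properties
  using ( ≤-refl; ≤-reflexive; ≤-trans; module ≤-Reasoning; 1+n≰n; ⊔-lub; +-suc; +-comm
        ; +-assoc; *-identityʳ; m≤m+n; m≤n+m; m≤m*n; +-mono-≤; +-monoˡ-≤; +-monoʳ-≤
        ; *-mono-≤; *-monoʳ-≤)
open import Data.Product using (Σ; ∃; _×_; _,_)
open import Function.Consequences.Propositional using (strictlySurjective⇒surjective)
open import Function.Definitions using (Injective; Surjective; StrictlySurjective)
open import Relation.Binary.PropositionalEquality
  using (_≡_; _≢_; refl; sym; trans; cong; cong₂)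
open import Relation.Nullary using (¬_; Dec; yes; no; ¬?; ⌊_⌋; contradiction)
open import Relation.Nullary.Decidable
  using (_×-dec_; isYes≗does; dec-true; dec-false; decidable-stable)

-- A neutral deduction may be the major premise of a further elimination
-- without creating a detour, so chains of eliminations stay normal.
Neutral : ∀ {A : Set} → List (Form A) → Form A → ℕ → Set
Neutral Γ φ h = Σ (Γ ⊢ φ) λ d → Normal d × ¬ IntroOr∨E d × height d ≤ h

module _ {A : Set} {Γ : List (Form A)} where

  weaken : ∀ {φ h h′} → h ≤ h′ → Neutral Γ φ h → Neutral Γ φ h′
  weaken h≤h′ (d , nd , ed , hd) = d , nd , ed , ≤-trans hd h≤h′

  assume : ∀ {φ h} → φ ∈ Γ → Neutral Γ φ (suc h)
  assume φ∈Γ = ass φ∈Γ , _ , (λ ()) , s≤s z≤n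

  ∧E₁ⁿ : ∀ {φ ψ h} → Neutral Γ (φ ∧' ψ) h → Neutral Γ φ (suc h)
  ∧E₁ⁿ (d , nd , ed , hd) = ∧E₁ d , (ed , nd) , (λ ()) , s≤s hd

  ∧E₂ⁿ : ∀ {φ ψ h} → Neutral Γ (φ ∧' ψ) h → Neutral Γ ψ (suc h)
  ∧E₂ⁿ (d , nd , ed , hd) = ∧E₂ d , (ed , nd) , (λ ()) , s≤s hd

  ⇒Eⁿ : ∀ {φ ψ h} → Neutral Γ (φ ⇒ ψ) h → Neutral Γ φ h → Neutral Γ ψ (suc h)
  ⇒Eⁿ (d , nd , ed , hd) (e , ne , _ , he) =
    ⇒E d e , (ed , nd , ne) , (λ ()) , s≤s (⊔-lub hd he)

  ⋀-proj : ∀ {φ xs h} → φ ∈ xs → Neutral Γ (⋀ xs) h → Neutral Γ φ (h + length xs)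
  ⋀-proj {xs = _ ∷ []}        (here refl) d = weaken (m≤m+n _ 1) d
  ⋀-proj {xs = _ ∷ _ ∷ _} {h} (here refl) d =
    weaken (≤-trans (m≤m+n (suc h) _) (≤-reflexive (sym (+-suc h _)))) (∧E₁ⁿ d)
  ⋀-proj {xs = _ ∷ _ ∷ _} {h} (there φ∈) d =
    weaken (≤-reflexive (sym (+-suc h _))) (⋀-proj φ∈ (∧E₂ⁿ d))

  ⋀-map-proj : ∀ {B : Set} {f : B → Form A} {x xs h k} → x ∈ xs → length xs ≤ k →
               Neutral Γ (⋀ (map f xs)) h → Neutral Γ (f x) (h + k)
  ⋀-map-proj {f = f} {xs = xs} x∈xs xs≤k d =
    weaken (+-monoʳ-≤ _ (≤-trans (≤-reflexive (length-map f xs)) xs≤k)) (⋀-proj (∈-map⁺ f x∈xs) d)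

∈-concatMap : ∀ {A B : Set} {f : A → List B} {x xs y} → x ∈ xs → y ∈ f x → y ∈ concatMap f xs
∈-concatMap {f = f} x∈xs y∈fx = ∈-concatMap⁺ f (Any.map (λ { refl → y∈fx }) x∈xs)

length-concatMap-≤ : ∀ {A B : Set} (f : A → List B) {k} (xs : List A) →
                     (∀ x → length (f x) ≤ k) → length (concatMap f xs) ≤ length xs * k
length-concatMap-≤ f []       _     = z≤n
length-concatMap-≤ f (x ∷ xs) f≤k rewrite length-++ (f x) {concatMap f xs} =
  +-mono-≤ (f≤k x) (length-concatMap-≤ f xs f≤k)

⌊⌋-true : ∀ {P : Set} (P? : Dec P) → P → ⌊ P? ⌋ ≡ true
⌊⌋-true P? p = trans (isYes≗does P?) (dec-true P? p)

⌊⌋-false : ∀ {P : Set} (P? : Dec P) → ¬ P → ⌊ P? ⌋ ≡ false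
⌊⌋-false P? ¬p = trans (isYes≗does P?) (dec-false P? ¬p)

∈-if-true : ∀ {B : Set} {c} {x : B} {xs ys} → c ≡ true → x ∈ xs → x ∈ (if c then xs else ys)
∈-if-true refl x∈xs = x∈xs

∈-if-false : ∀ {B : Set} {c} {x : B} {xs ys} → c ≡ false → x ∈ ys → x ∈ (if c then xs else ys)
∈-if-false refl x∈ys = x∈ys

length-if-≤ : ∀ {B : Set} c {xs ys : List B} {k} →
              length xs ≤ k → length ys ≤ k → length (if c then xs else ys) ≤ k
length-if-≤ true  xs≤k _    = xs≤k
length-if-≤ false _    ys≤k = ys≤k

n≤n*n : ∀ n → n ≤ n * n
n≤n*n zero      = z≤n
n≤n*n n@(suc _) = m≤m*n n n

length-allFin : ∀ n → length (allFin n) ≡ n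
length-allFin n = length-tabulate (λ i → i)

length-allFin-≤ : ∀ n → length (allFin n) ≤ n * n
length-allFin-≤ n = ≤-trans (≤-reflexive (length-allFin n)) (n≤n*n n)

module _ {B : Set} {n : ℕ} where

  pairList : (Fin n → Fin n → List B) → List B
  pairList g = concatMap (λ a → concatMap (λ b → g a b) (allFin n)) (allFin n)

  ∈-pairList : ∀ {g} a b {y} → y ∈ g a b → y ∈ pairList g
  ∈-pairList a b y∈ = ∈-concatMap (∈-allFin a) (∈-concatMap (∈-allFin b) y∈)

  length-pairList-≤ : ∀ g → (∀ a b → length (g a b) ≤ 1) → length (pairList g) ≤ n * n
  length-pairList-≤ g g≤1 = begin
    length (pairList g)                       ≤⟨ length-concatMap-≤ _ (allFin n) (λ a →
                                                   length-concatMap-≤ _ (allFin n) (g≤1 a)) ⟩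
    length (allFin n) * (length (allFin n) * 1) ≡⟨ cong₂ _*_ (length-allFin n)
                                                   (trans (*-identityʳ _) (length-allFin n)) ⟩
    n * n                                     ∎
    where open ≤-Reasoning

∈-distinctPairs : ∀ {n} {a b : Fin n} → a ≢ b → (a , b) ∈ distinctPairs n
∈-distinctPairs {a = a} {b} a≢b =
  ∈-pairList a b (∈-if-false (⌊⌋-false (a ≟ b) a≢b) (here refl))

∈-nonEdges : ∀ {n} (G : Graph n) {a b} → G a b ≡ false → (a , b) ∈ nonEdges G
∈-nonEdges G {a} {b} ¬ab = ∈-pairList a b (∈-if-false ¬ab (here refl))

∈-succPairs : ∀ {n} {a b : Fin n} → Succ a b → (a , b) ∈ succPairs n
∈-succPairs {a = a} {b} ab = ∈-pairList a b (∈-if-true (⌊⌋-true (toℕ b ℕ.≟ suc (toℕ a)) ab) (here refl))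

length-distinctPairs-≤ : ∀ n → length (distinctPairs n) ≤ n * n
length-distinctPairs-≤ n = length-pairList-≤ {n = n} _ (λ a b → length-if-≤ ⌊ a ≟ b ⌋ z≤n ≤-refl)

length-nonEdges-≤ : ∀ {n} (G : Graph n) → length (nonEdges G) ≤ n * n
length-nonEdges-≤ {n} G = length-pairList-≤ {n = n} _ (λ a b → length-if-≤ (G a b) z≤n ≤-refl)

length-succPairs-≤ : ∀ n → length (succPairs n) ≤ n * n
length-succPairs-≤ n =
  length-pairList-≤ {n = n} _ (λ a b → length-if-≤ ⌊ toℕ b ℕ.≟ suc (toℕ a) ⌋ ≤-refl z≤n)

injective⇒surjective : ∀ {n} {f : Fin n → Fin n} → Injective _≡_ _≡_ f → Surjective _≡_ _≡_ f
injective⇒surjective {zero}      _   ()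
injective⇒surjective {suc n} {f} inj = strictlySurjective⇒surjective hits
  where
  hits : StrictlySurjective _≡_ f
  hits y with any? (λ x → f x ≟ y)
  ... | yes hit = hit
  ... | no miss = contradiction (injective⇒≤ squeeze-injective) 1+n≰n
    where
    squeeze : Fin (suc n) → Fin n
    squeeze x = punchOut {i = y} {j = f x} (λ y≡fx → miss (x , sym y≡fx))
    squeeze-injective : Injective _≡_ _≡_ squeeze
    squeeze-injective eq = inj (punchOut-injective {i = y} _ _ eq)

7+m+m≤9*m : ∀ {m} → 1 ≤ m → 7 + m + m ≤ 9 * m
7+m+m≤9*m {m} 1≤m = begin
  7 + m + m       ≡⟨ cong (_+ m) (+-comm 7 m) ⟩
  m + 7 + m       ≡⟨ +-assoc m 7 m ⟩
  m + (7 + m)     ≡⟨ cong (m +_) (+-comm 7 m) ⟩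
  m + (m + 7)     ≤⟨ +-monoʳ-≤ m (+-monoʳ-≤ m (*-monoʳ-≤ 7 1≤m)) ⟩
  m + (m + 7 * m) ≡⟨⟩
  9 * m           ∎
  where open ≤-Reasoning

module _ {n : ℕ} (G : Graph n) (p : Fin n → Fin n) where

  data Defect : Set where
    collision   : ∀ {i j} → i ≢ j → p i ≡ p j → Defect
    missingEdge : ∀ {i j} → Succ i j → G (p i) (p j) ≡ false → Defect

  defect? : Dec Defect
  defect? with any? (λ i → any? (λ j → ¬? (i ≟ j) ×-dec (p i ≟ p j)))
             | any? (λ i → any? (λ j → (toℕ j ℕ.≟ suc (toℕ i)) ×-dec (G (p i) (p j) Bool.≟ false)))
  ... | yes (_ , _ , i≢j , pi≡pj) | _                       = yes (collision i≢j pi≡pj)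
  ... | no _                      | yes (_ , _ , ij , ¬pipj) = yes (missingEdge ij ¬pipj)
  ... | no ¬col                   | no ¬mis = no λ where
    (collision i≢j pi≡pj)  → ¬col (_ , _ , i≢j , pi≡pj)
    (missingEdge ij ¬pipj) → ¬mis (_ , _ , ij , ¬pipj)

  defect-free⇒hamiltonian : ¬ Defect → HamiltonianPath G p
  defect-free⇒hamiltonian ¬defect = (injective , injective⇒surjective injective) , edges
    where
    injective : Injective _≡_ _≡_ p
    injective {i} {j} pi≡pj = decidable-stable (i ≟ j) (λ i≢j → ¬defect (collision i≢j pi≡pj))
    edges : ∀ i j → Succ i j → G (p i) (p j) ≡ true
    edges i j ij = Bool.¬-not (λ ¬pipj → ¬defect (missingEdge ij ¬pipj))

  nonHamiltonian⇒defect : NonHamiltonian G → Defect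
  nonHamiltonian⇒defect nonHam =
    decidable-stable defect? (λ ¬defect → nonHam (p , defect-free⇒hamiltonian ¬defect))

  X-hyp : ∀ i → X i (p i) ∈ Hyps G p
  X-hyp i = there (∈-map⁺ _ (∈-allFin i))

  refute-clash : ∀ {i j v w h} → Neutral (Hyps G p) (X i v ⇒ X j w ⇒ ⊥') (suc h) →
                 p i ≡ v → p j ≡ w → Neutral (Hyps G p) ⊥' (3 + h)
  refute-clash {i} {j} clash refl refl = ⇒Eⁿ (⇒Eⁿ clash (assume (X-hyp i))) (assume (X-hyp j))

  refute-collision : ∀ {i j} → i ≢ j → p i ≡ p j → Neutral (Hyps G p) ⊥' (7 + n * n + n * n)
  refute-collision {i} {j} i≢j pi≡pj =
    weaken (+-monoˡ-≤ (n * n) (+-monoˡ-≤ (n * n) (m≤n+m 5 2)))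
           (refute-clash atVertex refl (sym pi≡pj))
    where
    B : Neutral (Hyps G p) (Bᶠ G) 3
    B = ∧E₁ⁿ (∧E₂ⁿ (assume (here refl)))
    atVertex : Neutral (Hyps G p) (X i (p i) ⇒ X j (p i) ⇒ ⊥') (3 + n * n + n * n)
    atVertex = ⋀-map-proj (∈-distinctPairs i≢j) (length-distinctPairs-≤ n)
                 (⋀-map-proj (∈-allFin (p i)) (length-allFin-≤ n) B)

  refute-missingEdge : ∀ {i j} → Succ i j → G (p i) (p j) ≡ false →
                       Neutral (Hyps G p) ⊥' (7 + n * n + n * n)
  refute-missingEdge {i} {j} ij ¬pipj = refute-clash atSucc refl refl
    where
    E′ : Neutral (Hyps G p) (E'ᶠ G) 5
    E′ = ∧E₂ⁿ (∧E₂ⁿ (∧E₂ⁿ (∧E₂ⁿ (assume (here refl)))))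
    atSucc : Neutral (Hyps G p) (X i (p i) ⇒ X j (p j) ⇒ ⊥') (5 + n * n + n * n)
    atSucc = ⋀-map-proj (∈-succPairs ij) (length-succPairs-≤ n)
               (⋀-map-proj (∈-nonEdges G ¬pipj) (length-nonEdges-≤ G) E′)

  refute : Defect → Neutral (Hyps G p) ⊥' (7 + n * n + n * n)
  refute (collision i≢j pi≡pj)  = refute-collision i≢j pi≡pj
  refute (missingEdge ij ¬pipj) = refute-missingEdge ij ¬pipj

lemma8 : ∃ λ (c : ℕ) →
           ∀ (n : ℕ) → 0 < n → (G : Graph n) → NonHamiltonian G →
           (p : Fin n → Fin n) →
           Σ (Hyps G p ⊢ ⊥') λ Π → Normal Π × height Π ≤ c * (n * n)
lemma8 = 9 , λ n 0<n G nonHam p →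
  let Π , normal , _ , height≤ = refute G p (nonHamiltonian⇒defect G p nonHam)
  in  Π , normal , ≤-trans height≤ (7+m+m≤9*m (*-mono-≤ 0<n 0<n))
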